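{- Let $\mathcal H\subseteq 2^V$ be a hypergraph, $V=V_1\dot\cup V_2$, and $S_0,S_1,S_2\subseteq V_1$ pairwise disjoint nonempty sets. Let $\mathcal H_1=\mathcal H_{V_1}$, $\mathcal H_2=\mathcal H_{V_2}$, $\mathcal F_1=\{H\in\mathcal H\mid H\cap V_1=S_0\cup S_2,\ H\cap V_2\ne\emptyset\}$, $\mathcal F_2=\{H\in\mathcal H\mid H\cap V_1=S_0\cup S_1,\ H\cap V_2\ne\emptyset\}$, and suppose $\mathcal H=\mathcal H_1\cup\mathcal H_2\cup\mathcal F_1\cup\mathcal F_2$ and $\mathcal H_1=\{S_0\cup S_1\cup S_2\}$. Then $\operatorname{Tr}(\mathcal H)=\big(\{\{v\}\mid v\in S_0\}\,\dot\wedge\,\operatorname{Tr}(\mathcal H_2)\big)\ \dot\cup\ \operatorname{Tr}(\mathcal H^{V\setminus S_0})$.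
   Context: $\operatorname{Tr}(\mathcal G)$ is the family of inclusion-minimal transversals of $\mathcal G$ (sets meeting every hyperedge), with $\operatorname{Tr}(\emptyset)=\{\emptyset\}$. $\mathcal H_S=\{H\in\mathcal H\mid H\subseteq S\}$ and $\mathcal H^S=\operatorname{Min}\{H\cap S\mid H\in\mathcal H\}$, where $\operatorname{Min}$ takes inclusion-minimal members. For families $\mathcal A,\mathcal B$ on disjoint vertex sets, $\mathcal A\dot\wedge\mathcal B=\operatorname{Min}\{A\cup B\mid A\in\mathcal A,B\in\mathcal B\}$; $\dot\cup$ denotes a union of disjoint families. -}

module Defs where

open import Data.Nat using (ℕ)
open import Data.Fin using (Fin)
open import Data.Fin.Subset
open import Data.Product using (Σ; ∃; _×_; _,_)
open import Data.Sum using (_⊎_)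
open import Relation.Binary.PropositionalEquality using (_≡_)
open import Relation.Nullary using (¬_)

-- A family of subsets of V = Fin n, given as a predicate on subsets.
Family : ℕ → Set₁
Family n = Subset n → Set

private variable n : ℕ

_≐_ : Family n → Family n → Set
𝒜 ≐ ℬ = ∀ X → (𝒜 X → ℬ X) × (ℬ X → 𝒜 X)

_∪F_ : Family n → Family n → Family n
(𝒜 ∪F ℬ) X = 𝒜 X ⊎ ℬ X

Min : Family n → Family n
Min 𝒜 X = 𝒜 X × (∀ Y → 𝒜 Y → Y ⊆ X → Y ≡ X)

IsTransversal : Family n → Subset n → Set
IsTransversal 𝒢 T = ∀ G → 𝒢 G → Nonempty (G ∩ T)

Tr : Family n → Family n
Tr 𝒢 = Min (IsTransversal 𝒢)

restrict : Family n → Subset n → Family n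
restrict 𝒢 S G = 𝒢 G × G ⊆ S

trace : Family n → Subset n → Family n
trace 𝒢 S = Min (λ X → ∃ λ G → 𝒢 G × X ≡ G ∩ S)

_∧̇_ : Family n → Family n → Family n
(𝒜 ∧̇ ℬ) = Min (λ X → ∃ λ A → ∃ λ B → 𝒜 A × ℬ B × X ≡ A ∪ B)

singletons : Subset n → Family n
singletons S X = ∃ λ v → v ∈ S × X ≡ ⁅ v ⁆

_≐_∪̇_ : Family n → Family n → Family n → Set
𝒞 ≐ 𝒜 ∪̇ ℬ = (𝒞 ≐ (𝒜 ∪F ℬ)) × (∀ X → ¬ (𝒜 X × ℬ X))

module Submission where

-- Every edge either contains S₀ or lies in V₂. A minimal transversal X meeting S₀
-- in a vertex v therefore only needs v to cover the edges through S₀, so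
-- X = {v} ∪ (X ∩ V₂) with X ∩ V₂ ∈ Tr(ℋ_{V₂}); conversely the edge S₀ ∪ S₁ ∪ S₂ ⊆ V₁
-- forces every transversal inside {v} ∪ B, B ⊆ V₂, to contain v. A minimal
-- transversal avoiding S₀ is the same thing as a minimal transversal of the
-- trace ℋ^{V ∖ S₀}.

open import Defs
open import Data.Nat using (ℕ)
open import Data.Nat.Induction using (<-wellFounded)
open import Data.Fin using (Fin)
open import Data.Fin.Subset
open import Data.Fin.Subset.Properties
open import Data.Product using (_×_; _,_; ∃; proj₁; proj₂)
open import Data.Sum using (_⊎_; inj₁; inj₂)
open import Induction.WellFounded using (WellFounded; Acc; acc; module Subrelation)
open import Relation.Binary.Construct.On as On using ()
open import Relation.Nullary using (¬_; yes; no; contradiction)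
open import Relation.Nullary.Decidable using (decidable-stable)
open import Relation.Binary.PropositionalEquality using (_≡_; refl; sym; cong; subst)

module _ {n : ℕ} where

  ⊆⇒Empty-∩∁ : {p q : Subset n} → p ⊆ q → Empty (p ∩ ∁ q)
  ⊆⇒Empty-∩∁ {p} {q} p⊆q (x , x∈p∩∁q) =
    let x∈p , x∈∁q = x∈p∩q⁻ p (∁ q) x∈p∩∁q in x∈∁p⇒x∉p x∈∁q (p⊆q x∈p)

  Empty-∩⇒⊆∁ : {p q : Subset n} → Empty (p ∩ q) → p ⊆ ∁ q
  Empty-∩⇒⊆∁ p∩q-empty x∈p = x∉p⇒x∈∁p (λ x∈q → p∩q-empty (_ , x∈p∩q⁺ (x∈p , x∈q)))

  ∩-nonempty-mono : {p p′ q q′ : Subset n} → p ⊆ p′ → q ⊆ q′ →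
                    Nonempty (p ∩ q) → Nonempty (p′ ∩ q′)
  ∩-nonempty-mono {p} {q = q} p⊆p′ q⊆q′ (x , x∈p∩q) =
    let x∈p , x∈q = x∈p∩q⁻ p q x∈p∩q in x , x∈p∩q⁺ (p⊆p′ x∈p , q⊆q′ x∈q)

  ∩-monoˡ-⊆ : {p p′ q : Subset n} → p ⊆ p′ → p ∩ q ⊆ p′ ∩ q
  ∩-monoˡ-⊆ {p} {q = q} p⊆p′ x∈p∩q =
    let x∈p , x∈q = x∈p∩q⁻ p q x∈p∩q in x∈p∩q⁺ (p⊆p′ x∈p , x∈q)

  ⊆∧⊄⇒≡ : {p q : Subset n} → p ⊆ q → ¬ (p ⊂ q) → p ≡ q
  ⊆∧⊄⇒≡ {p} p⊆q p⊄q = ⊆-antisym p⊆q λ {x} x∈q →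
    decidable-stable (x ∈? p) (λ x∉p → p⊄q (p⊆q , x , x∈q , x∉p))

  ⊂-wellFounded : WellFounded (_⊂_ {n})
  ⊂-wellFounded = Subrelation.wellFounded p⊂q⇒∣p∣<∣q∣ (On.wellFounded ∣_∣ <-wellFounded)

  -- Membership in 𝒜 is not decidable, so a minimal member below Z exists only
  -- up to double negation; this suffices for decidable conclusions.
  Min-below : (𝒜 : Family n) {Z : Subset n} → 𝒜 Z → ¬ ¬ (∃ λ E → E ⊆ Z × Min 𝒜 E)
  Min-below 𝒜 = go (⊂-wellFounded _)
    where
    go : ∀ {Z} → Acc _⊂_ Z → 𝒜 Z → ¬ ¬ (∃ λ E → E ⊆ Z × Min 𝒜 E)
    go {Z} (acc rs) Z∈𝒜 no-min = no-min (Z , ⊆-refl , Z∈𝒜 , minimal)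
      where
      minimal : ∀ Y → 𝒜 Y → Y ⊆ Z → Y ≡ Z
      minimal Y Y∈𝒜 Y⊆Z = ⊆∧⊄⇒≡ Y⊆Z λ Y⊂Z →
        go (rs Y⊂Z) Y∈𝒜 λ (E , E⊆Y , E-min) → no-min (E , ⊆-trans E⊆Y Y⊆Z , E-min)

  Min-subfamily : {𝒜 ℬ : Family n} {X : Subset n} →
                  (∀ Y → ℬ Y → 𝒜 Y) → ℬ X → Min 𝒜 X → Min ℬ X
  Min-subfamily ℬ⊆𝒜 X∈ℬ (_ , X-min) = X∈ℬ , λ Y Y∈ℬ → X-min Y (ℬ⊆𝒜 Y Y∈ℬ)

  IsTransversal-Min : {𝒢 : Family n} {X : Subset n} →
                      IsTransversal (Min 𝒢) X → IsTransversal 𝒢 X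
  IsTransversal-Min {𝒢} {X} X-tr G G∈𝒢 =
    decidable-stable (nonempty? (G ∩ X)) λ G∩X-empty →
      Min-below 𝒢 G∈𝒢 λ (E , E⊆G , E-min) →
        G∩X-empty (∩-nonempty-mono E⊆G ⊆-refl (X-tr E E-min))

  IsTransversal-restrict : {𝒢 : Family n} {X : Subset n} (W : Subset n) →
                           IsTransversal 𝒢 X → IsTransversal (restrict 𝒢 W) (X ∩ W)
  IsTransversal-restrict {X = X} W X-tr G (G∈𝒢 , G⊆W) with X-tr G G∈𝒢
  ... | x , x∈G∩X = let x∈G , x∈X = x∈p∩q⁻ G X x∈G∩X in
                    x , x∈p∩q⁺ (x∈G , x∈p∩q⁺ (x∈X , G⊆W x∈G))

  IsTransversal-trace⁺ : {𝒢 : Family n} {S X : Subset n} → X ⊆ S →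
                         IsTransversal 𝒢 X → IsTransversal (trace 𝒢 S) X
  IsTransversal-trace⁺ {X = X} X⊆S X-tr _ ((G , G∈𝒢 , refl) , _) with X-tr G G∈𝒢
  ... | x , x∈G∩X = let x∈G , x∈X = x∈p∩q⁻ G X x∈G∩X in
                    x , x∈p∩q⁺ (x∈p∩q⁺ (x∈G , X⊆S x∈X) , x∈X)

  IsTransversal-trace⁻ : {𝒢 : Family n} {S X : Subset n} →
                         IsTransversal (trace 𝒢 S) X → IsTransversal 𝒢 X
  IsTransversal-trace⁻ {S = S} {X} X-tr G G∈𝒢 =
    ∩-nonempty-mono (p∩q⊆p G S) ⊆-refl (IsTransversal-Min X-tr (G ∩ S) (G , G∈𝒢 , refl))

  Tr-⊆ : {𝒢 : Family n} {W X : Subset n} → (∀ G → 𝒢 G → G ⊆ W) → Tr 𝒢 X → X ⊆ W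
  Tr-⊆ {W = W} {X} edges⊆W (X-tr , X-min) =
    ⊆-trans (⊆-reflexive (sym X∩W≡X)) (p∩q⊆q X W)
    where
    X∩W≡X : X ∩ W ≡ X
    X∩W≡X = X-min (X ∩ W)
      (λ G G∈𝒢 → IsTransversal-restrict W X-tr G (G∈𝒢 , edges⊆W G G∈𝒢)) (p∩q⊆p X W)

  Tr-trace⁺ : {𝒢 : Family n} {S X : Subset n} → X ⊆ S → Tr 𝒢 X → Tr (trace 𝒢 S) X
  Tr-trace⁺ X⊆S X-Tr@(X-tr , _) =
    Min-subfamily (λ _ → IsTransversal-trace⁻) (IsTransversal-trace⁺ X⊆S X-tr) X-Tr

  Tr-trace⁻ : {𝒢 : Family n} {S X : Subset n} → Tr (trace 𝒢 S) X → Tr 𝒢 X × X ⊆ S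
  Tr-trace⁻ {S = S} {X} X-Tr@(X-tr , X-min) =
    (IsTransversal-trace⁻ X-tr , λ Y Y-tr Y⊆X →
       X-min Y (IsTransversal-trace⁺ (⊆-trans Y⊆X X⊆S) Y-tr) Y⊆X) , X⊆S
    where
    X⊆S : X ⊆ S
    X⊆S = Tr-⊆ (λ { _ ((G , _ , refl) , _) → p∩q⊆q G S }) X-Tr

module Split {n : ℕ} (ℋ : Family n) (W S₀ : Subset n)
             (S₀∩W-empty : Empty (S₀ ∩ W))
             (edge-dichotomy : ∀ H → ℋ H → S₀ ⊆ H ⊎ H ⊆ W)
             (E : Subset n) (E∈ℋ : ℋ E) (E∩W-empty : Empty (E ∩ W)) where

  𝒢 : Family n
  𝒢 = restrict ℋ W

  ⁅v⁆∪-∩⊆ : {v : Fin n} (B : Subset n) → v ∈ S₀ → (⁅ v ⁆ ∪ B) ∩ W ⊆ B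
  ⁅v⁆∪-∩⊆ {v} B v∈S₀ x∈ with x∈p∩q⁻ (⁅ v ⁆ ∪ B) W x∈
  ... | x∈⁅v⁆∪B , x∈W with x∈p∪q⁻ ⁅ v ⁆ B x∈⁅v⁆∪B
  ...   | inj₂ x∈B = x∈B
  ...   | inj₁ x∈⁅v⁆ rewrite x∈⁅y⁆⇒x≡y v x∈⁅v⁆ =
            contradiction (_ , x∈p∩q⁺ (v∈S₀ , x∈W)) S₀∩W-empty

  ⁅v⁆∪-transversal : {v : Fin n} {B : Subset n} → v ∈ S₀ →
                     IsTransversal 𝒢 B → IsTransversal ℋ (⁅ v ⁆ ∪ B)
  ⁅v⁆∪-transversal {v} {B} v∈S₀ B-tr H H∈ℋ with edge-dichotomy H H∈ℋ
  ... | inj₁ S₀⊆H = v , x∈p∩q⁺ (S₀⊆H v∈S₀ , p⊆p∪q B (x∈⁅x⁆ v))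
  ... | inj₂ H⊆W  = ∩-nonempty-mono ⊆-refl (q⊆p∪q ⁅ v ⁆ B) (B-tr H (H∈ℋ , H⊆W))

  ⁅v⁆∪-Tr : {v : Fin n} {B : Subset n} → v ∈ S₀ → Tr 𝒢 B → Tr ℋ (⁅ v ⁆ ∪ B)
  ⁅v⁆∪-Tr {v} {B} v∈S₀ B-Tr@(B-tr , B-min) = ⁅v⁆∪-transversal v∈S₀ B-tr , minimal
    where
    minimal : ∀ Y → IsTransversal ℋ Y → Y ⊆ ⁅ v ⁆ ∪ B → Y ≡ ⁅ v ⁆ ∪ B
    minimal Y Y-tr Y⊆⁅v⁆∪B = ⊆-antisym Y⊆⁅v⁆∪B ⁅v⁆∪B⊆Y
      where
      v∈Y : v ∈ Y
      v∈Y with Y-tr E E∈ℋ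
      ... | y , y∈E∩Y with x∈p∩q⁻ E Y y∈E∩Y
      ...   | y∈E , y∈Y with x∈p∪q⁻ ⁅ v ⁆ B (Y⊆⁅v⁆∪B y∈Y)
      ...     | inj₁ y∈⁅v⁆ = subst (_∈ Y) (x∈⁅y⁆⇒x≡y v y∈⁅v⁆) y∈Y
      ...     | inj₂ y∈B =
                contradiction (y , x∈p∩q⁺ (y∈E , Tr-⊆ (λ _ → proj₂) B-Tr y∈B)) E∩W-empty
      Y∩W≡B : Y ∩ W ≡ B
      Y∩W≡B = B-min (Y ∩ W) (IsTransversal-restrict W Y-tr)
                    (⊆-trans (∩-monoˡ-⊆ Y⊆⁅v⁆∪B) (⁅v⁆∪-∩⊆ B v∈S₀))
      ⁅v⁆∪B⊆Y : ⁅ v ⁆ ∪ B ⊆ Y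
      ⁅v⁆∪B⊆Y x∈ with x∈p∪q⁻ ⁅ v ⁆ B x∈
      ... | inj₁ x∈⁅v⁆ = subst (_∈ Y) (sym (x∈⁅y⁆⇒x≡y v x∈⁅v⁆)) v∈Y
      ... | inj₂ x∈B = p∩q⊆p Y W (subst (_ ∈_) (sym Y∩W≡B) x∈B)

  Tr-meeting-S₀ : {v : Fin n} {X : Subset n} → Tr ℋ X → v ∈ X → v ∈ S₀ →
               Tr 𝒢 (X ∩ W) × ⁅ v ⁆ ∪ (X ∩ W) ≡ X
  Tr-meeting-S₀ {v} {X} (X-tr , X-min) v∈X v∈S₀ = (B-tr , B-min) , ⁅v⁆∪-≡X B-tr ⊆-refl
    where
    B = X ∩ W
    B-tr : IsTransversal 𝒢 B
    B-tr = IsTransversal-restrict W X-tr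
    ⁅v⁆∪-≡X : ∀ {Z} → IsTransversal 𝒢 Z → Z ⊆ B → ⁅ v ⁆ ∪ Z ≡ X
    ⁅v⁆∪-≡X {Z} Z-tr Z⊆B = X-min (⁅ v ⁆ ∪ Z) (⁅v⁆∪-transversal v∈S₀ Z-tr) ⁅v⁆∪Z⊆X
      where
      ⁅v⁆∪Z⊆X : ⁅ v ⁆ ∪ Z ⊆ X
      ⁅v⁆∪Z⊆X x∈ with x∈p∪q⁻ ⁅ v ⁆ Z x∈
      ... | inj₁ x∈⁅v⁆ = subst (_∈ X) (sym (x∈⁅y⁆⇒x≡y v x∈⁅v⁆)) v∈X
      ... | inj₂ x∈Z = p∩q⊆p X W (Z⊆B x∈Z)
    B-min : ∀ Z → IsTransversal 𝒢 Z → Z ⊆ B → Z ≡ B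
    B-min Z Z-tr Z⊆B = ⊆-antisym Z⊆B
      (⊆-trans (⊆-reflexive (cong (_∩ W) (sym (⁅v⁆∪-≡X Z-tr Z⊆B)))) (⁅v⁆∪-∩⊆ Z v∈S₀))

  Tr-split : Tr ℋ ≐ (singletons S₀ ∧̇ Tr 𝒢) ∪̇ Tr (trace ℋ (∁ S₀))
  Tr-split = (λ X → to , from) , disjoint
    where
    to : ∀ {X} → Tr ℋ X → (singletons S₀ ∧̇ Tr 𝒢) X ⊎ Tr (trace ℋ (∁ S₀)) X
    to {X} X-Tr with nonempty? (X ∩ S₀)
    ... | no X∩S₀-empty = inj₂ (Tr-trace⁺ (Empty-∩⇒⊆∁ X∩S₀-empty) X-Tr)
    ... | yes (v , v∈X∩S₀) with x∈p∩q⁻ X S₀ v∈X∩S₀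
    ...   | v∈X , v∈S₀ with Tr-meeting-S₀ X-Tr v∈X v∈S₀
    ...     | B-Tr , ⁅v⁆∪B≡X =
              inj₁ (Min-subfamily products-transversal
                      (⁅ v ⁆ , X ∩ W , (v , v∈S₀ , refl) , B-Tr , sym ⁅v⁆∪B≡X) X-Tr)
      where
      products-transversal : ∀ Y → (∃ λ A → ∃ λ B → singletons S₀ A × Tr 𝒢 B × Y ≡ A ∪ B) →
                             IsTransversal ℋ Y
      products-transversal _ (_ , _ , (w , w∈S₀ , refl) , (B-tr , _) , refl) =
        ⁅v⁆∪-transversal w∈S₀ B-tr
    from : ∀ {X} → (singletons S₀ ∧̇ Tr 𝒢) X ⊎ Tr (trace ℋ (∁ S₀)) X → Tr ℋ X
    from (inj₁ ((_ , _ , (v , v∈S₀ , refl) , B-Tr , refl) , _)) = ⁅v⁆∪-Tr v∈S₀ B-Tr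
    from (inj₂ X-Tr) = proj₁ (Tr-trace⁻ X-Tr)
    disjoint : ∀ X → ¬ ((singletons S₀ ∧̇ Tr 𝒢) X × Tr (trace ℋ (∁ S₀)) X)
    disjoint _ (((_ , B , (v , v∈S₀ , refl) , _ , refl) , _) , X-Tr) =
      x∈∁p⇒x∉p (proj₂ (Tr-trace⁻ X-Tr) (p⊆p∪q B (x∈⁅x⁆ v))) v∈S₀

lemma4 : (n : ℕ) (ℋ : Family n) (V₁ S₀ S₁ S₂ : Subset n) →
    S₀ ⊆ V₁ → S₁ ⊆ V₁ → S₂ ⊆ V₁ →
    Empty (S₀ ∩ S₁) → Empty (S₀ ∩ S₂) → Empty (S₁ ∩ S₂) →
    Nonempty S₀ → Nonempty S₁ → Nonempty S₂ →
    ℋ ≐ (restrict ℋ V₁ ∪F (restrict ℋ (∁ V₁)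
          ∪F ((λ H → ℋ H × (H ∩ V₁ ≡ S₀ ∪ S₂) × Nonempty (H ∩ ∁ V₁))
          ∪F (λ H → ℋ H × (H ∩ V₁ ≡ S₀ ∪ S₁) × Nonempty (H ∩ ∁ V₁))))) →
    restrict ℋ V₁ ≐ (λ X → X ≡ S₀ ∪ (S₁ ∪ S₂)) →
    Tr ℋ ≐ (singletons S₀ ∧̇ Tr (restrict ℋ (∁ V₁))) ∪̇ Tr (trace ℋ (∁ S₀))
lemma4 _ ℋ V₁ S₀ S₁ S₂ S₀⊆V₁ _ _ _ _ _ _ _ _ ℋ-cases ℋ₁≐ =
  Split.Tr-split ℋ (∁ V₁) S₀ (⊆⇒Empty-∩∁ S₀⊆V₁) edge-dichotomy
                 (S₀ ∪ (S₁ ∪ S₂)) (proj₁ E∈ℋ₁) (⊆⇒Empty-∩∁ (proj₂ E∈ℋ₁))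
  where
  E∈ℋ₁ : restrict ℋ V₁ (S₀ ∪ (S₁ ∪ S₂))
  E∈ℋ₁ = proj₂ (ℋ₁≐ _) refl
  S₀⊆ : ∀ {H T} → H ≡ S₀ ∪ T → S₀ ⊆ H
  S₀⊆ {T = T} H≡S₀∪T = ⊆-trans (p⊆p∪q T) (⊆-reflexive (sym H≡S₀∪T))
  S₀⊆-of-∩V₁ : ∀ {H T} → H ∩ V₁ ≡ S₀ ∪ T → S₀ ⊆ H
  S₀⊆-of-∩V₁ {H} H∩V₁≡S₀∪T = ⊆-trans (S₀⊆ H∩V₁≡S₀∪T) (p∩q⊆p H V₁)
  edge-dichotomy : ∀ H → ℋ H → S₀ ⊆ H ⊎ H ⊆ ∁ V₁
  edge-dichotomy H H∈ℋ with proj₁ (ℋ-cases H) H∈ℋ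
  ... | inj₁ H∈ℋ₁                          = inj₁ (S₀⊆ (proj₁ (ℋ₁≐ H) H∈ℋ₁))
  ... | inj₂ (inj₁ (_ , H⊆∁V₁))            = inj₂ H⊆∁V₁
  ... | inj₂ (inj₂ (inj₁ (_ , H∩V₁≡ , _))) = inj₁ (S₀⊆-of-∩V₁ H∩V₁≡)
  ... | inj₂ (inj₂ (inj₂ (_ , H∩V₁≡ , _))) = inj₁ (S₀⊆-of-∩V₁ H∩V₁≡)
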